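{- Let $U$ be a non-empty set and let $z,r,e\subseteq U\times U$ be pairwise distinct binary relations on $U$ satisfying $r;e=r=e;r$, $r;r=r$, $z;r=z=r;z$, and $r\cap e=z$, where $a;b=\{(x,y): \exists w\in U,\ (x,w)\in a,\ (w,y)\in b\}$ denotes relational composition. Then $U$ is infinite. -}

module Defs where

open import Level using (0ℓ)
open import Data.Nat using (ℕ)
open import Data.Fin using (Fin)
open import Data.Product using (Σ; ∃; _×_; _,_)
open import Function.Bundles using (_↔_)
open import Relation.Binary.Core using (Rel)

BinRel : Set → Set₁
BinRel U = Rel U 0ℓ

_⨾_ : {U : Set} → BinRel U → BinRel U → BinRel U
(a ⨾ b) x y = ∃ λ w → a x w × b w y

_∩_ : {U : Set} → BinRel U → BinRel U → BinRel U
(a ∩ b) x y = a x y × b x y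

_≐_ : {U : Set} → BinRel U → BinRel U → Set
_≐_ {U} a b = ((x y : U) → a x y → b x y) × ((x y : U) → b x y → a x y)

Finite : Set → Set
Finite U = Σ ℕ λ n → U ↔ Fin n

-- A relation r that
-- is transitive and dense has, on a finite set, a reflexive point w between any
-- r-related x and y: descend from y by repeatedly interpolating between x and
-- the current point, and apply the pigeonhole principle to the descending chain.
-- A reflexive point of r is one of z (using r ⊆ r⨾e, e⨾r ⊆ r and r ∩ e ⊆ z),
-- so z⨾r ⊆ z and r⨾z ⊆ z put r x y into z. Hence r ⊆ z ⊆ r, contradicting z ≠ r.
module Submission where

open import Defs
open import Data.Product using (Σ; ∃; ∃₂; _×_; _,_; proj₁; proj₂)
open import Relation.Nullary using (¬_)
open import Data.Nat using (ℕ; zero; suc; _<_; _<′_; ≤′-refl; ≤′-step; z<s; s<s)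
open import Data.Nat.Properties using (n<1+n; <⇒<′)
open import Data.Fin using (toℕ)
open import Data.Fin.Properties using (pigeonhole)
open import Function using (_∘_)
open import Function.Bundles using (Inverse; Injection)
open import Function.Properties.Inverse using (↔⇒↣)
open import Relation.Binary.Core using (_⇒_)
open import Relation.Binary.Definitions using (Transitive)
open import Relation.Binary.PropositionalEquality using (_≡_; sym; subst)

≐⇒⊆ : {U : Set} {a b : BinRel U} → a ≐ b → a ⇒ b
≐⇒⊆ (a⊆b , _) = a⊆b _ _

≐⇒⊇ : {U : Set} {a b : BinRel U} → a ≐ b → b ⇒ a
≐⇒⊇ (_ , b⊆a) = b⊆a _ _

finite-pigeonhole : {U : Set} → Finite U → (f : ℕ → U) →
                    ∃₂ λ i j → i < j × f i ≡ f j
finite-pigeonhole (n , U↔Fin) f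
  with i , j , i<j , same-image ← pigeonhole (n<1+n n) (Inverse.to U↔Fin ∘ f ∘ toℕ)
  = toℕ i , toℕ j , i<j , Injection.injective (↔⇒↣ U↔Fin) same-image

module DenseTransitive {U : Set} {r : BinRel U}
  (dense : r ⇒ (r ⨾ r)) (transitive : Transitive r) where

  descent : ∀ {x y} → r x y → ℕ → Σ U (r x)
  descent {y = y} rxy zero = y , rxy
  descent rxy (suc k) with _ , rxm , _ ← dense (proj₂ (descent rxy k)) = _ , rxm

  module _ {x y : U} (rxy : r x y) where

    point : ℕ → U
    point = proj₁ ∘ descent rxy

    descent-step : ∀ k → r (point (suc k)) (point k)
    descent-step k with dense (proj₂ (descent rxy k))
    ... | _ , _ , rmp = rmp

    descent-decreasing : ∀ {i j} → i <′ j → r (point j) (point i)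
    descent-decreasing {i}         ≤′-refl        = descent-step i
    descent-decreasing {j = suc j} (≤′-step i<j) = transitive (descent-step j) (descent-decreasing i<j)

  reflexive-between : Finite U → ∀ {x y} → r x y →
                      ∃ λ w → r x w × r w w × r w y
  reflexive-between fin rxy
    with i , j , i<j , same ← finite-pigeonhole fin (point rxy ∘ suc)
    = point rxy (suc i)
    , proj₂ (descent rxy (suc i))
    , subst (λ v → r v (point rxy (suc i))) (sym same)
        (descent-decreasing rxy {suc i} {suc j} (<⇒<′ (s<s i<j)))
    , descent-decreasing rxy {0} {suc i} (<⇒<′ z<s)

theorem2 : (U : Set) → U → (z r e : BinRel U) →
    ¬ (z ≐ r) → ¬ (z ≐ e) → ¬ (r ≐ e) →
    (r ⨾ e) ≐ r → (e ⨾ r) ≐ r → (r ⨾ r) ≐ r →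
    (z ⨾ r) ≐ z → (r ⨾ z) ≐ z → (r ∩ e) ≐ z →
    ¬ Finite U
theorem2 U _ z r e z≉r _ _ r⨾e≐r e⨾r≐r r⨾r≐r z⨾r≐z r⨾z≐z r∩e≐z fin = z≉r ((λ _ _ → z⊆r) , λ _ _ → r⊆z)
  where
  z⊆r : ∀ {x y} → z x y → r x y
  z⊆r = proj₁ ∘ ≐⇒⊇ r∩e≐z

  reflexive-in-z : ∀ {w} → r w w → z w w
  reflexive-in-z rww with u , rwu , euw ← ≐⇒⊇ r⨾e≐r rww
    = ≐⇒⊆ r⨾z≐z (u , rwu , ≐⇒⊆ r∩e≐z (≐⇒⊆ e⨾r≐r (_ , euw , rww) , euw))

  open DenseTransitive (≐⇒⊇ r⨾r≐r) (λ rxy ryz → ≐⇒⊆ r⨾r≐r (_ , rxy , ryz))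

  r⊆z : ∀ {x y} → r x y → z x y
  r⊆z rxy with w , rxw , rww , rwy ← reflexive-between fin rxy
    = ≐⇒⊆ r⨾z≐z (w , rxw , ≐⇒⊆ z⨾r≐z (w , reflexive-in-z rww , rwy))
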